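{- Let $B>1$ and $N>1$ be integers with $\gcd(N,B)=1$, let $e=\operatorname{ord}(B,N)=3k$, and suppose $N\in M_3(B)$. Then: (i) $m_3(1)=1$; (ii) if $N$ is odd, $m_3(2)=1$; (iii) if $3\nmid N$ and $N\ne 7$, $m_3(3)=1$.
   Context: $\operatorname{ord}(B,N)$ is the least positive integer $e$ with $B^e\equiv1\pmod N$. For a divisor $d$ of $e$ put $k=e/d$. For $x$ with $1\le x<N$, $\gcd(x,N)=1$, let $x/N=0.a_1a_2\ldots$ be its base-$B$ expansion (purely periodic with period $a_1\ldots a_e$), and let $S_d(x)=\sum_{j=1}^d\sum_{i=1}^k a_{(j-1)k+i}B^{k-i}$ be the sum of the integers represented in base $B$ by the $d$ consecutive blocks of length $k$ of the period. We say $N\in M_d(B)$ if $d\mid e$ and $S_d(x)\equiv0\pmod{B^k-1}$ for every such $x$. When $N\in M_d(B)$, the multiplier is the integer $m_d(x)=S_d(x)/(B^k-1)$; thus $m_3(x)=1$ means the three blocks of length $k$ of the period of $x/N$ sum to exactly $B^k-1$. -}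

module Defs where

open import Data.Nat using (ℕ; zero; suc; _+_; _*_; _∸_; _^_; _<_; _≤_; NonZero)
open import Data.Nat.DivMod using (_/_; _%_)
open import Data.Nat.Divisibility using (_∣_)
open import Data.Nat.GCD using (gcd)
open import Data.Product using (Σ; _×_)
open import Relation.Nullary using (¬_)
open import Relation.Binary.PropositionalEquality using (_≡_)

sumTo : ℕ → (ℕ → ℕ) → ℕ
sumTo zero    f = 0
sumTo (suc n) f = sumTo n f + f (suc n)

PowOne : (B N e : ℕ) → .{{NonZero N}} → Set
PowOne B N e = B ^ e % N ≡ 1 % N

IsOrd : (B N e : ℕ) → .{{NonZero N}} → Set
IsOrd B N e =
  (0 < e) × PowOne B N e × (∀ e' → 0 < e' → e' < e → ¬ PowOne B N e')

-- digit B N x i = a_i, the i-th (i ≥ 1) digit after the point of the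
-- base-B expansion of x/N:  a_i = floor(x B^i / N) mod B
digit : (B N x i : ℕ) → .{{NonZero B}} → .{{NonZero N}} → ℕ
digit B N x i = ((x * B ^ i) / N) % B

-- block B N k x j = Σ_{i=1}^{k} a_{(j-1)k+i} B^{k-i}
-- (the integer represented by the j-th block of length k)
block : (B N k x j : ℕ) → .{{NonZero B}} → .{{NonZero N}} → ℕ
block B N k x j = sumTo k (λ i → digit B N x ((j ∸ 1) * k + i) * B ^ (k ∸ i))

-- S_d(x) with k = e/d
S : (B N d k x : ℕ) → .{{NonZero B}} → .{{NonZero N}} → ℕ
S B N d k x = sumTo d (λ j → block B N k x j)

-- N ∈ M_d(B): d ∣ e = ord(B,N) (i.e. e = d*k, k = e/d) and
-- S_d(x) ≡ 0 (mod B^k - 1) for all 1 ≤ x < N with gcd(x,N) = 1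
InM : (d B N : ℕ) → .{{NonZero B}} → .{{NonZero N}} → Set
InM d B N = Σ ℕ λ k → IsOrd B N (d * k) ×
  (∀ x → 1 ≤ x → x < N → gcd x N ≡ 1 → (B ^ k ∸ 1) ∣ S B N d k x)

-- MultIs B N d k x m : the multiplier m_d(x) = S_d(x)/(B^k - 1) equals m
-- (stated multiplicatively; B^k - 1 > 0 whenever B > 1, k > 0)
MultIs : (B N d k x m : ℕ) → .{{NonZero B}} → .{{NonZero N}} → Set
MultIs B N d k x m = S B N d k x ≡ m * (B ^ k ∸ 1)

{-# OPTIONS --safe #-}
-- Write r_j = x Bʲ mod N. Long division of x by N gives
-- N · (j-th block of x/N) + r_{jk} = Bᵏ r_{(j-1)k}, and summing over the d blocks of a period
-- (where r_{dk} = r_0) gives N S_d(x) = (Bᵏ - 1)(r_0 + r_k + ⋯ + r_{(d-1)k}): the multiplier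
-- m_d(x) is this remainder sum divided by N.
-- For d = 3 let y = Bᵏ mod N and z = B²ᵏ mod N. The hypothesis N ∈ M₃(B) at x = 1 makes
-- 1 + y + z, which is below 2N, a multiple of N; so m₃(1) = 1 and 1 + y + z = N, whence
-- N ∣ y² + y + 1 as y² ≡ z. Minimality of the order gives y, z ≥ 2, so N ≥ 5. For c = 2, 3
-- the remainder sum c + (cy mod N) + (cz mod N) is N or 2N. In the second case cy ≡ -i and
-- cz ≡ -j (mod N) with i, j ≥ 1 and i + j = c, and c²(y² + y + 1) = (cy + i)(cy + j) + (i² + ij + j²)
-- gives N ∣ i² + ij + j², which is 3 for c = 2 and 7 for c = 3.
module Submission where

open import Defs
open import Data.Nat using (ℕ; _*_; _<_; NonZero)
open import Data.Nat.Divisibility using (_∣_)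
open import Data.Nat.GCD using (gcd)
open import Data.Product using (_×_)
open import Relation.Nullary using (¬_)
open import Relation.Binary.PropositionalEquality using (_≡_; _≢_)

open import Data.Nat using (zero; suc; _+_; _∸_; _^_; _≤_; s≤s; z<s; >-nonZero)
open import Data.Nat.Properties
open import Algebra.Properties.CommutativeSemigroup +-commutativeSemigroup
  using () renaming (xy∙z≈xz∙y to +-right-comm)
open import Data.Nat.DivMod
  using (_/_; _%_; m≡m%n+[m/n]*n; m%n<n; m<n⇒m%n≡m; m%n%n≡m%n; %-distribˡ-*;
         [m+kn]%n≡m%n; /-congˡ; +-distrib-/-∣ʳ; m*n/n≡m; m<n*o⇒m/o<n)
open import Data.Nat.Divisibility
  using (divides; divides-refl; n∣m*n; ∣m+n∣m⇒∣n; ∣m⇒∣m*n; ∣n⇒∣m*n; ∣⇒≤)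
open import Data.Nat.GCD using (gcd-zeroˡ)
open import Data.Nat.Primality using (prime?; prime⇒irreducible)
open import Data.Nat.Tactic.RingSolver using (solve-∀)
open import Data.Product using (∃₂; _,_; proj₁; proj₂)
open import Data.Sum using (_⊎_; inj₁; inj₂; [_,_]′)
open import Data.Empty using (⊥-elim)
open import Function.Base using (id)
open import Function.Bundles using (_⇔_; mk⇔; module Equivalence)
open import Relation.Binary.Definitions using (tri<; tri≈; tri>)
open import Relation.Binary.PropositionalEquality using (refl; sym; trans; cong; cong₂; subst)
open import Relation.Nullary.Decidable using (from-yes)
open Relation.Binary.PropositionalEquality.≡-Reasoning

*-%-congˡ : ∀ N .{{_ : NonZero N}} {a b} c → a % N ≡ b % N → (a * c) % N ≡ (b * c) % N
*-%-congˡ N {a} {b} c eq = begin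
  (a * c) % N             ≡⟨ %-distribˡ-* a c N ⟩
  ((a % N) * (c % N)) % N ≡⟨ cong (λ w → (w * (c % N)) % N) eq ⟩
  ((b % N) * (c % N)) % N ≡⟨ %-distribˡ-* b c N ⟨
  (b * c) % N             ∎

*-%-congʳ : ∀ N .{{_ : NonZero N}} {a b} c → a % N ≡ b % N → (c * a) % N ≡ (c * b) % N
*-%-congʳ N {a} {b} c eq = begin
  (c * a) % N ≡⟨ cong (_% N) (*-comm c a) ⟩
  (a * c) % N ≡⟨ *-%-congˡ N c eq ⟩
  (b * c) % N ≡⟨ cong (_% N) (*-comm b c) ⟩
  (c * b) % N ∎

fromDigits : ℕ → (ℕ → ℕ) → ℕ → ℕ
fromDigits B f n = sumTo n (λ i → f i * B ^ (n ∸ i))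

fromDigits-suc : ∀ B f n → fromDigits B f (suc n) ≡ B * fromDigits B f n + f (suc n)
fromDigits-suc B f n = cong₂ _+_ (shift n ≤-refl)
  (trans (cong (λ e → f (suc n) * B ^ e) (n∸n≡0 n)) (*-identityʳ (f (suc n))))
  where
  shift : ∀ m → m ≤ n →
    sumTo m (λ i → f i * B ^ (suc n ∸ i)) ≡ B * sumTo m (λ i → f i * B ^ (n ∸ i))
  shift zero    _   = sym (*-zeroʳ B)
  shift (suc m) m<n = begin
    sumTo m (λ i → f i * B ^ (suc n ∸ i)) + f (suc m) * B ^ (n ∸ m)
      ≡⟨ cong₂ _+_ (shift m (<⇒≤ m<n)) (cong (λ e → f (suc m) * B ^ e) (+-∸-assoc 1 m<n)) ⟩
    B * sumTo m (λ i → f i * B ^ (n ∸ i)) + f (suc m) * (B * B ^ (n ∸ suc m))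
      ≡⟨ factor B (sumTo m (λ i → f i * B ^ (n ∸ i))) (f (suc m)) (B ^ (n ∸ suc m)) ⟩
    B * (sumTo m (λ i → f i * B ^ (n ∸ i)) + f (suc m) * B ^ (n ∸ suc m)) ∎
    where
    factor : ∀ B s a b → B * s + a * (B * b) ≡ B * (s + a * b)
    factor = solve-∀

sumTo-shift : ∀ f d → sumTo d f + f 0 ≡ sumTo d (λ j → f (j ∸ 1)) + f d
sumTo-shift f zero    = refl
sumTo-shift f (suc d) = begin
  sumTo d f + f (suc d) + f 0   ≡⟨ +-right-comm (sumTo d f) (f (suc d)) (f 0) ⟩
  sumTo d f + f 0 + f (suc d)   ≡⟨ cong (_+ f (suc d)) (sumTo-shift f d) ⟩
  sumTo d (λ j → f (j ∸ 1)) + f d + f (suc d) ∎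

eisenstein : ℕ → ℕ → ℕ
eisenstein i j = i * i + i * j + j * j

∣eisenstein : ∀ {N y} i j → N ∣ y * y + y + 1 → N ∣ (i + j) * y + i → N ∣ eisenstein i j
∣eisenstein {N} {y} i j N∣cyclotomic N∣cy+i = ∣m+n∣m⇒∣n
  (subst (N ∣_) (identity i j y) (∣n⇒∣m*n ((i + j) * (i + j)) N∣cyclotomic))
  (∣m⇒∣m*n ((i + j) * y + j) N∣cy+i)
  where
  identity : ∀ i j y → (i + j) * (i + j) * (y * y + y + 1)
                     ≡ ((i + j) * y + i) * ((i + j) * y + j) + (i * i + i * j + j * j)
  identity = solve-∀

eisenstein-sum≡2 : ∀ i j → suc i + suc j ≡ 2 → eisenstein (suc i) (suc j) ≡ 3
eisenstein-sum≡2 zero          zero    refl = refl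
eisenstein-sum≡2 zero          (suc j) ()
eisenstein-sum≡2 (suc zero)    j       ()
eisenstein-sum≡2 (suc (suc i)) j       ()

eisenstein-sum≡3 : ∀ i j → suc i + suc j ≡ 3 → eisenstein (suc i) (suc j) ≡ 7
eisenstein-sum≡3 zero                zero          ()
eisenstein-sum≡3 zero                (suc zero)    refl = refl
eisenstein-sum≡3 zero                (suc (suc j)) ()
eisenstein-sum≡3 (suc zero)          zero          refl = refl
eisenstein-sum≡3 (suc zero)          (suc j)       ()
eisenstein-sum≡3 (suc (suc zero))    j             ()
eisenstein-sum≡3 (suc (suc (suc i))) j             ()

multiple-of-N-below-3N : ∀ {N c u v} t → c + u + v ≡ t * N → 0 < c → c ≤ N → u < N → v < N →
  t ≡ 1 ⊎ ∃₂ λ i j → suc i + suc j ≡ c × u + suc i ≡ N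
multiple-of-N-below-3N {N} {c} {u} {v} t eq 0<c c≤N u<N v<N =
  cases t (*-cancelʳ-< N t 3 (subst (_< 3 * N) eq c+u+v<3N)) eq
  where
  triple : ∀ N → N + N + N ≡ 3 * N
  triple = solve-∀
  c+u+v<3N : c + u + v < 3 * N
  c+u+v<3N = subst (c + u + v <_) (triple N) (+-mono-< (+-mono-≤-< c≤N u<N) v<N)
  complement : ∀ {w} → w < N → w + suc (N ∸ suc w) ≡ N
  complement {w} w<N = trans (+-suc w (N ∸ suc w)) (m+[n∸m]≡n w<N)
  cases : ∀ t → t < 3 → c + u + v ≡ t * N →
    t ≡ 1 ⊎ ∃₂ λ i j → suc i + suc j ≡ c × u + suc i ≡ N
  cases zero             _ eq =
    ⊥-elim (<⇒≱ 0<c (subst (c ≤_) eq (≤-trans (m≤m+n c u) (m≤m+n (c + u) v))))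
  cases (suc zero)       _ _  = inj₁ refl
  cases (suc (suc zero)) _ eq = inj₂ (i , j , +-cancelʳ-≡ (u + v) (suc i + suc j) c (begin
    suc i + suc j + (u + v)       ≡⟨ regroup (suc i) (suc j) u v ⟩
    (u + suc i) + (v + suc j)     ≡⟨ cong₂ _+_ (complement u<N) (complement v<N) ⟩
    N + N                         ≡⟨ cong (N +_) (+-identityʳ N) ⟨
    2 * N                         ≡⟨ eq ⟨
    c + u + v                     ≡⟨ +-assoc c u v ⟩
    c + (u + v)                   ∎) , complement u<N)
    where
    i = N ∸ suc u
    j = N ∸ suc v
    regroup : ∀ i j u v → i + j + (u + v) ≡ (u + i) + (v + j)
    regroup = solve-∀
  cases (suc (suc (suc _))) (s≤s (s≤s (s≤s ()))) _

multiplier⇔ : ∀ {N P S R} m .{{_ : NonZero N}} → 1 < P → N * S + R ≡ P * R →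
  S ≡ m * (P ∸ 1) ⇔ R ≡ m * N
multiplier⇔ {N} {P} {S} {R} m 1<P eq = mk⇔ to from
  where
  instance
    P∸1≢0 : NonZero (P ∸ 1)
    P∸1≢0 = >-nonZero (m<n⇒0<n∸m 1<P)
  swap : ∀ m a b → a * (m * b) ≡ b * (m * a)
  swap = solve-∀
  N*S≡[P∸1]*R : N * S ≡ (P ∸ 1) * R
  N*S≡[P∸1]*R = +-cancelʳ-≡ R _ _ (begin
    N * S + R               ≡⟨ eq ⟩
    P * R                   ≡⟨ cong (_* R) (m∸n+n≡m (<⇒≤ 1<P)) ⟨
    (P ∸ 1 + 1) * R         ≡⟨ *-distribʳ-+ R (P ∸ 1) 1 ⟩
    (P ∸ 1) * R + 1 * R     ≡⟨ cong ((P ∸ 1) * R +_) (*-identityˡ R) ⟩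
    (P ∸ 1) * R + R         ∎)
  to : S ≡ m * (P ∸ 1) → R ≡ m * N
  to S≡ = *-cancelˡ-≡ R (m * N) (P ∸ 1) (begin
    (P ∸ 1) * R         ≡⟨ N*S≡[P∸1]*R ⟨
    N * S               ≡⟨ cong (N *_) S≡ ⟩
    N * (m * (P ∸ 1))   ≡⟨ swap m N (P ∸ 1) ⟩
    (P ∸ 1) * (m * N)   ∎)
  from : R ≡ m * N → S ≡ m * (P ∸ 1)
  from R≡ = *-cancelˡ-≡ S (m * (P ∸ 1)) N (begin
    N * S               ≡⟨ N*S≡[P∸1]*R ⟩
    (P ∸ 1) * R         ≡⟨ cong ((P ∸ 1) *_) R≡ ⟩
    (P ∸ 1) * (m * N)   ≡⟨ swap m (P ∸ 1) N ⟩
    N * (m * (P ∸ 1))   ∎)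

IsOrd-unique : ∀ {B N e e′} .{{_ : NonZero N}} → IsOrd B N e → IsOrd B N e′ → e ≡ e′
IsOrd-unique {e = e} {e′} (0<e , Bᵉ≡1 , least) (0<e′ , Bᵉ′≡1 , least′) with <-cmp e e′
... | tri< e<e′ _ _ = ⊥-elim (least′ e 0<e e<e′ Bᵉ≡1)
... | tri≈ _ e≡e′ _ = e≡e′
... | tri> _ _ e′<e = ⊥-elim (least e′ 0<e′ e′<e Bᵉ′≡1)

module Expansion (B N : ℕ) .{{_ : NonZero B}} .{{_ : NonZero N}} where

  quot rem : ℕ → ℕ → ℕ
  quot x i = (x * B ^ i) / N
  rem  x i = (x * B ^ i) % N

  rem+quot*N : ∀ x i → x * B ^ i ≡ rem x i + quot x i * N
  rem+quot*N x i = m≡m%n+[m/n]*n (x * B ^ i) N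

  rem<N : ∀ x i → rem x i < N
  rem<N x i = m%n<n (x * B ^ i) N

  rem-zero : ∀ {x} → x < N → rem x 0 ≡ x
  rem-zero {x} x<N = trans (cong (_% N) (*-identityʳ x)) (m<n⇒m%n≡m x<N)

  rem-+ : ∀ x m n → rem x (m + n) ≡ rem (rem x m) n
  rem-+ x m n = begin
    (x * B ^ (m + n)) % N       ≡⟨ cong (λ p → (x * p) % N) (^-distribˡ-+-* B m n) ⟩
    (x * (B ^ m * B ^ n)) % N   ≡⟨ cong (_% N) (*-assoc x (B ^ m) (B ^ n)) ⟨
    (x * B ^ m * B ^ n) % N     ≡⟨ *-%-congˡ N (B ^ n) (m%n%n≡m%n (x * B ^ m) N) ⟨
    (rem x m * B ^ n) % N       ∎

  rem-scale : ∀ c j → rem c j ≡ (c * rem 1 j) % N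
  rem-scale c j = *-%-congʳ N c (begin
    B ^ j % N           ≡⟨ cong (_% N) (*-identityˡ (B ^ j)) ⟨
    (1 * B ^ j) % N     ≡⟨ m%n%n≡m%n (1 * B ^ j) N ⟨
    rem 1 j % N         ∎)

  rem-period : ∀ x e → PowOne B N e → rem x e ≡ rem x 0
  rem-period x _ Bᵉ≡1 = *-%-congʳ N x Bᵉ≡1

  -- The carry ⌊B r_i / N⌋ is below B, so it is the last base-B digit of the new quotient.
  quot-suc : ∀ x i → quot x (suc i) ≡ B * quot x i + digit B N x (suc i)
  quot-suc x i = begin
    quot x (suc i)             ≡⟨ quot≡carry+B*quot ⟩
    carry + B * quot x i       ≡⟨ +-comm carry (B * quot x i) ⟩
    B * quot x i + carry       ≡⟨ cong (B * quot x i +_) digit≡carry ⟨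
    B * quot x i + digit B N x (suc i) ∎
    where
    carry = (B * rem x i) / N
    shifted : x * B ^ suc i ≡ B * rem x i + B * quot x i * N
    shifted = begin
      x * (B * B ^ i)                 ≡⟨ *-assoc x B (B ^ i) ⟨
      x * B * B ^ i                   ≡⟨ cong (_* B ^ i) (*-comm x B) ⟩
      B * x * B ^ i                   ≡⟨ *-assoc B x (B ^ i) ⟩
      B * (x * B ^ i)                 ≡⟨ cong (B *_) (rem+quot*N x i) ⟩
      B * (rem x i + quot x i * N)    ≡⟨ distribute B (rem x i) (quot x i) N ⟩
      B * rem x i + B * quot x i * N  ∎
      where
      distribute : ∀ B r q N → B * (r + q * N) ≡ B * r + B * q * N
      distribute = solve-∀
    quot≡carry+B*quot : quot x (suc i) ≡ carry + B * quot x i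
    quot≡carry+B*quot = begin
      (x * B ^ suc i) / N                       ≡⟨ /-congˡ shifted ⟩
      (B * rem x i + B * quot x i * N) / N
        ≡⟨ +-distrib-/-∣ʳ (B * rem x i) (divides-refl (B * quot x i)) ⟩
      carry + (B * quot x i * N) / N            ≡⟨ cong (carry +_) (m*n/n≡m (B * quot x i) N) ⟩
      carry + B * quot x i                      ∎
    carry<B : carry < B
    carry<B = m<n*o⇒m/o<n (*-monoʳ-< B (rem<N x i))
    digit≡carry : digit B N x (suc i) ≡ carry
    digit≡carry = begin
      quot x (suc i) % B              ≡⟨ cong (_% B) quot≡carry+B*quot ⟩
      (carry + B * quot x i) % B      ≡⟨ cong (λ w → (carry + w) % B) (*-comm B (quot x i)) ⟩
      (carry + quot x i * B) % B      ≡⟨ [m+kn]%n≡m%n carry (quot x i) B ⟩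
      carry % B                       ≡⟨ m<n⇒m%n≡m carry<B ⟩
      carry                           ∎

  readDigits : ℕ → ℕ → ℕ → ℕ
  readDigits x m = fromDigits B (λ i → digit B N x (m + i))

  readDigits+quot : ∀ x m n → readDigits x m n + B ^ n * quot x m ≡ quot x (m + n)
  readDigits+quot x m zero = trans (+-identityʳ (quot x m)) (cong (quot x) (sym (+-identityʳ m)))
  readDigits+quot x m (suc n) = begin
    readDigits x m (suc n) + B * B ^ n * quot x m
      ≡⟨ cong (_+ B * B ^ n * quot x m) (fromDigits-suc B (λ i → digit B N x (m + i)) n) ⟩
    B * readDigits x m n + a + B * B ^ n * quot x m
      ≡⟨ regroup B (readDigits x m n) a (B ^ n) (quot x m) ⟩
    B * (readDigits x m n + B ^ n * quot x m) + a
      ≡⟨ cong (λ w → B * w + a) (readDigits+quot x m n) ⟩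
    B * quot x (m + n) + a
      ≡⟨ cong (λ w → B * quot x (m + n) + digit B N x w) (+-suc m n) ⟩
    B * quot x (m + n) + digit B N x (suc (m + n))
      ≡⟨ quot-suc x (m + n) ⟨
    quot x (suc (m + n))
      ≡⟨ cong (quot x) (+-suc m n) ⟨
    quot x (m + suc n) ∎
    where
    a = digit B N x (m + suc n)
    regroup : ∀ B h a b q → B * h + a + B * b * q ≡ B * (h + b * q) + a
    regroup = solve-∀

  N*readDigits+rem : ∀ x m n → N * readDigits x m n + rem x (m + n) ≡ B ^ n * rem x m
  N*readDigits+rem x m n = +-cancelʳ-≡ (Bⁿ * quot x m * N) _ _ (begin
    N * h + rem x (m + n) + Bⁿ * quot x m * N   ≡⟨ regroup N h (rem x (m + n)) Bⁿ (quot x m) ⟩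
    rem x (m + n) + (h + Bⁿ * quot x m) * N     ≡⟨ cong (λ w → rem x (m + n) + w * N) blockQuot ⟩
    rem x (m + n) + quot x (m + n) * N          ≡⟨ rem+quot*N x (m + n) ⟨
    x * B ^ (m + n)                             ≡⟨ cong (x *_) (^-distribˡ-+-* B m n) ⟩
    x * (B ^ m * Bⁿ)                            ≡⟨ shuffle x (B ^ m) Bⁿ ⟩
    Bⁿ * (x * B ^ m)                            ≡⟨ cong (Bⁿ *_) (rem+quot*N x m) ⟩
    Bⁿ * (rem x m + quot x m * N)               ≡⟨ distribute Bⁿ (rem x m) (quot x m) N ⟩
    Bⁿ * rem x m + Bⁿ * quot x m * N            ∎)
    where
    h  = readDigits x m n
    Bⁿ = B ^ n
    blockQuot = readDigits+quot x m n
    regroup : ∀ N h r P q → N * h + r + P * q * N ≡ r + (h + P * q) * N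
    regroup = solve-∀
    shuffle : ∀ x a b → x * (a * b) ≡ b * (x * a)
    shuffle = solve-∀
    distribute : ∀ P r q N → P * (r + q * N) ≡ P * r + P * q * N
    distribute = solve-∀

  remSum : ℕ → ℕ → ℕ → ℕ
  remSum d k x = sumTo d (λ j → rem x ((j ∸ 1) * k))

  N*S+shiftedRemSum : ∀ d k x →
    N * S B N d k x + sumTo d (λ j → rem x (j * k)) ≡ B ^ k * remSum d k x
  N*S+shiftedRemSum zero k x = begin
    N * 0 + 0       ≡⟨ +-identityʳ (N * 0) ⟩
    N * 0           ≡⟨ *-zeroʳ N ⟩
    0               ≡⟨ *-zeroʳ (B ^ k) ⟨
    B ^ k * 0       ∎
  N*S+shiftedRemSum (suc d) k x = begin
    N * (Sᵈ + b) + (Σᵈ + r)      ≡⟨ interchange N Sᵈ b Σᵈ r ⟩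
    (N * Sᵈ + Σᵈ) + (N * b + r)  ≡⟨ cong₂ _+_ (N*S+shiftedRemSum d k x) lastBlock ⟩
    B ^ k * remSum d k x + B ^ k * rem x (d * k)
                                 ≡⟨ *-distribˡ-+ (B ^ k) (remSum d k x) (rem x (d * k)) ⟨
    B ^ k * remSum (suc d) k x   ∎
    where
    Sᵈ = S B N d k x
    Σᵈ = sumTo d (λ j → rem x (j * k))
    b  = block B N k x (suc d)
    r  = rem x (suc d * k)
    interchange : ∀ N s b σ r → N * (s + b) + (σ + r) ≡ (N * s + σ) + (N * b + r)
    interchange = solve-∀
    lastBlock : N * b + r ≡ B ^ k * rem x (d * k)
    lastBlock = subst (λ e → N * readDigits x (d * k) k + rem x e ≡ B ^ k * rem x (d * k))
      (+-comm (d * k) k) (N*readDigits+rem x (d * k) k)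

  -- Over a full period the remainders r_{k}, …, r_{dk} are r_0, …, r_{(d-1)k} rotated.
  N*S+remSum : ∀ d k x → PowOne B N (d * k) →
    N * S B N d k x + remSum d k x ≡ B ^ k * remSum d k x
  N*S+remSum d k x period = subst (λ r → N * S B N d k x + r ≡ B ^ k * remSum d k x)
    (+-cancelʳ-≡ (rem x 0) _ _ (trans (sumTo-shift f d) (cong (remSum d k x +_) f[d]≡f[0])))
    (N*S+shiftedRemSum d k x)
    where
    f[d]≡f[0] = rem-period x (d * k) period
    f : ℕ → ℕ
    f j = rem x (j * k)

  multiplier≡⇔remSum≡ : ∀ d k x m → 1 < B → 0 < k → PowOne B N (d * k) →
    MultIs B N d k x m ⇔ remSum d k x ≡ m * N
  multiplier≡⇔remSum≡ d k x m 1<B 0<k period = multiplier⇔ m 1<Bᵏ (N*S+remSum d k x period)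
    where
    1<Bᵏ : 1 < B ^ k
    1<Bᵏ = <-≤-trans 1<B (≤-trans (m≤m*n B 1) (^-monoʳ-≤ B 0<k))

  1<rem1 : ∀ {e j} → 1 < N → IsOrd B N e → 0 < j → j < e → 1 < rem 1 j
  1<rem1 {e} {j} 1<N (_ , Bᵉ≡1 , least) 0<j j<e =
    ≤∧≢⇒< (n≢0⇒n>0 rem≢0) (λ 1≡rem → rem≢1 (sym 1≡rem))
    where
    rem≢1 : rem 1 j ≢ 1
    rem≢1 rem≡1 = least j 0<j j<e (begin
      B ^ j % N         ≡⟨ cong (_% N) (*-identityˡ (B ^ j)) ⟨
      rem 1 j           ≡⟨ rem≡1 ⟩
      1                 ≡⟨ m<n⇒m%n≡m 1<N ⟨
      1 % N             ∎)
    rem≢0 : rem 1 j ≢ 0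
    rem≢0 rem≡0 = 0≢1+n (begin
      0                       ≡⟨ m<n⇒m%n≡m (<-trans z<s 1<N) ⟨
      rem 0 (e ∸ j)           ≡⟨ cong (λ r → rem r (e ∸ j)) rem≡0 ⟨
      rem (rem 1 j) (e ∸ j)   ≡⟨ rem-+ 1 j (e ∸ j) ⟨
      rem 1 (j + (e ∸ j))     ≡⟨ cong (rem 1) (m+[n∸m]≡n (<⇒≤ j<e)) ⟩
      rem 1 e                 ≡⟨ rem-period 1 e Bᵉ≡1 ⟩
      rem 1 0                 ≡⟨ rem-zero 1<N ⟩
      1                       ∎)

module PeriodThree (B N k : ℕ) .{{_ : NonZero B}} .{{_ : NonZero N}} (1<B : 1 < B) (1<N : 1 < N)
  (ord : IsOrd B N (3 * k)) (M₃-at-1 : (B ^ k ∸ 1) ∣ S B N 3 k 1) where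
  open Expansion B N

  y z : ℕ
  y = rem 1 k
  z = rem 1 (2 * k)

  0<k : 0 < k
  0<k = *-cancelˡ-< 3 0 k (proj₁ ord)

  multiplier≡⇔ : ∀ c m → MultIs B N 3 k c m ⇔ remSum 3 k c ≡ m * N
  multiplier≡⇔ c m = multiplier≡⇔remSum≡ 3 k c m 1<B 0<k (proj₁ (proj₂ ord))

  remSum₃ : ∀ {c} → c < N → remSum 3 k c ≡ c + rem c k + rem c (2 * k)
  remSum₃ {c} c<N = cong₂ _+_ (cong₂ _+_ (rem-zero c<N) (cong (rem c) (+-identityʳ k))) refl

  remSum₁≡N : remSum 3 k 1 ≡ N
  remSum₁≡N = begin
    remSum 3 k 1 ≡⟨ remSum₁≡t*N ⟩
    t * N        ≡⟨ cong (_* N) t≡1 ⟩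
    1 * N        ≡⟨ *-identityˡ N ⟩
    N            ∎
    where
    open _∣_ M₃-at-1 renaming (quotient to t; equality to S≡t*[Bᵏ∸1])
    remSum₁≡t*N : remSum 3 k 1 ≡ t * N
    remSum₁≡t*N = Equivalence.to (multiplier≡⇔ 1 t) S≡t*[Bᵏ∸1]
    t≡1 : t ≡ 1
    t≡1 with multiple-of-N-below-3N t (trans (sym (remSum₃ 1<N)) remSum₁≡t*N)
               z<s (<⇒≤ 1<N) (rem<N 1 k) (rem<N 1 (2 * k))
    ... | inj₁ t≡1 = t≡1
    ... | inj₂ (i , j , sum≡1 , _) =
          ⊥-elim (1+n≢0 (trans (sym (+-suc i j)) (suc-injective sum≡1)))

  cycle : 1 + y + z ≡ N
  cycle = trans (sym (remSum₃ 1<N)) remSum₁≡N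

  multiplier-one : MultIs B N 3 k 1 1
  multiplier-one = Equivalence.from (multiplier≡⇔ 1 1) (trans remSum₁≡N (sym (*-identityˡ N)))

  4<N : 4 < N
  4<N = subst (4 <_) cycle (s≤s (+-mono-≤ (1<rem1 1<N ord 0<k k<3k) (1<rem1 1<N ord 0<2k 2k<3k)))
    where
    instance
      k≢0 : NonZero k
      k≢0 = >-nonZero 0<k
    0<2k : 0 < 2 * k
    0<2k = ≤-trans 0<k (m≤m+n k (1 * k))
    k<3k : k < 3 * k
    k<3k = m<m+n k 0<2k
    2k<3k : 2 * k < 3 * k
    2k<3k = *-monoˡ-< k {2} {3} ≤-refl

  y*y%N≡z : (y * y) % N ≡ z
  y*y%N≡z = begin
    (y * y) % N        ≡⟨ rem-scale y k ⟨
    rem y k            ≡⟨ rem-+ 1 k k ⟨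
    rem 1 (k + k)      ≡⟨ cong (λ e → rem 1 (k + e)) (+-identityʳ k) ⟨
    z                  ∎

  N∣cyclotomic : N ∣ y * y + y + 1
  N∣cyclotomic = divides (suc q) (begin
    y * y + y + 1                    ≡⟨ cong (λ w → w + y + 1) (m≡m%n+[m/n]*n (y * y) N) ⟩
    (y * y) % N + q * N + y + 1      ≡⟨ regroup ((y * y) % N) (q * N) y ⟩
    1 + y + (y * y) % N + q * N      ≡⟨ cong (λ w → 1 + y + w + q * N) y*y%N≡z ⟩
    1 + y + z + q * N                ≡⟨ cong (_+ q * N) cycle ⟩
    N + q * N                        ∎)
    where
    q = (y * y) / N
    regroup : ∀ r s y → r + s + y + 1 ≡ 1 + y + r + s
    regroup = solve-∀

  N∣remSum : ∀ {c} → c < N → N ∣ remSum 3 k c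
  N∣remSum {c} c<N = ∣m+n∣m⇒∣n (subst (N ∣_) (sym expand) (n∣m*n c)) (n∣m*n (a + b))
    where
    a = (c * y) / N
    b = (c * z) / N
    regroup : ∀ a b N c u v → (a + b) * N + (c + u + v) ≡ c + (u + a * N) + (v + b * N)
    regroup = solve-∀
    distribute : ∀ c y z → c + c * y + c * z ≡ c * (1 + y + z)
    distribute = solve-∀
    expand : (a + b) * N + remSum 3 k c ≡ c * N
    expand = begin
      (a + b) * N + remSum 3 k c
        ≡⟨ cong ((a + b) * N +_) (remSum₃ c<N) ⟩
      (a + b) * N + (c + rem c k + rem c (2 * k))
        ≡⟨ cong₂ (λ u v → (a + b) * N + (c + u + v)) (rem-scale c k) (rem-scale c (2 * k)) ⟩
      (a + b) * N + (c + (c * y) % N + (c * z) % N)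
        ≡⟨ regroup a b N c ((c * y) % N) ((c * z) % N) ⟩
      c + ((c * y) % N + a * N) + ((c * z) % N + b * N)
        ≡⟨ cong₂ (λ p q → c + p + q) (m≡m%n+[m/n]*n (c * y) N) (m≡m%n+[m/n]*n (c * z) N) ⟨
      c + c * y + c * z
        ≡⟨ distribute c y z ⟩
      c * (1 + y + z)
        ≡⟨ cong (c *_) cycle ⟩
      c * N ∎

  N∣cy+i : ∀ c i → rem c k + suc i ≡ N → N ∣ c * y + suc i
  N∣cy+i c i rem+i≡N = divides (suc a) (begin
    c * y + suc i                 ≡⟨ cong (_+ suc i) (m≡m%n+[m/n]*n (c * y) N) ⟩
    (c * y) % N + a * N + suc i   ≡⟨ +-right-comm ((c * y) % N) (a * N) (suc i) ⟩
    (c * y) % N + suc i + a * N   ≡⟨ cong (λ u → u + suc i + a * N) (rem-scale c k) ⟨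
    rem c k + suc i + a * N       ≡⟨ cong (_+ a * N) rem+i≡N ⟩
    N + a * N                     ∎)
    where
    a = (c * y) / N

  EisensteinDivisor : ℕ → Set
  EisensteinDivisor c = ∃₂ λ i j → suc i + suc j ≡ c × N ∣ eisenstein (suc i) (suc j)

  multiplier≡1⊎N∣eisenstein : ∀ c → 0 < c → c < N → MultIs B N 3 k c 1 ⊎ EisensteinDivisor c
  multiplier≡1⊎N∣eisenstein c 0<c c<N = conclude
    (multiple-of-N-below-3N {N} {c} {rem c k} {rem c (2 * k)} t
      (trans (sym (remSum₃ c<N)) remSum≡t*N) 0<c (<⇒≤ c<N) (rem<N c k) (rem<N c (2 * k)))
    where
    open _∣_ (N∣remSum c<N) renaming (quotient to t; equality to remSum≡t*N)
    conclude : t ≡ 1 ⊎ (∃₂ λ i j → suc i + suc j ≡ c × rem c k + suc i ≡ N) →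
      MultIs B N 3 k c 1 ⊎ EisensteinDivisor c
    conclude (inj₁ t≡1) =
      inj₁ (Equivalence.from (multiplier≡⇔ c 1) (trans remSum≡t*N (cong (_* N) t≡1)))
    conclude (inj₂ (i , j , sum≡c , rem+i≡N)) = inj₂ (i , j , sum≡c ,
      ∣eisenstein (suc i) (suc j) N∣cyclotomic
        (subst (λ c → N ∣ c * y + suc i) (sym sum≡c) (N∣cy+i c i rem+i≡N)))

  multiplier-two : MultIs B N 3 k 2 1
  multiplier-two = [ id , N∣3-impossible ]′
    (multiplier≡1⊎N∣eisenstein 2 z<s (<-trans (n<1+n 2) (<-trans (n<1+n 3) 4<N)))
    where
    N∣3-impossible : EisensteinDivisor 2 → MultIs B N 3 k 2 1
    N∣3-impossible (i , j , sum≡2 , N∣eis) = ⊥-elim (<⇒≱ (<-trans (n<1+n 3) 4<N) (∣⇒≤ N∣3))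
      where
      N∣3 = subst (N ∣_) (eisenstein-sum≡2 i j sum≡2) N∣eis

  multiplier-three : N ≢ 7 → MultIs B N 3 k 3 1
  multiplier-three N≢7 = [ id , N∣7-impossible ]′
    (multiplier≡1⊎N∣eisenstein 3 z<s (<-trans (n<1+n 3) 4<N))
    where
    N∣7-impossible : EisensteinDivisor 3 → MultIs B N 3 k 3 1
    N∣7-impossible (i , j , sum≡3 , N∣eis) =
      [ (λ N≡1 → ⊥-elim (<-irrefl (sym N≡1) 1<N)) , (λ N≡7 → ⊥-elim (N≢7 N≡7)) ]′
        (prime⇒irreducible (from-yes (prime? 7)) N∣7)
      where
      N∣7 = subst (N ∣_) (eisenstein-sum≡3 i j sum≡3) N∣eis

-- Of N ∈ M₃(B) only the case x = 1 is used.
theorem7 : (B N k : ℕ) → .{{_ : NonZero B}} → .{{_ : NonZero N}} →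
    1 < B → 1 < N → gcd N B ≡ 1 →
    IsOrd B N (3 * k) → InM 3 B N →
    MultIs B N 3 k 1 1
    × (¬ (2 ∣ N) → MultIs B N 3 k 2 1)
    × (¬ (3 ∣ N) → N ≢ 7 → MultIs B N 3 k 3 1)
theorem7 B N k 1<B 1<N _ ord (k′ , ord′ , M₃) =
  multiplier-one , (λ _ → multiplier-two) , (λ _ → multiplier-three)
  where
  k′≡k : k′ ≡ k
  k′≡k = *-cancelˡ-≡ k′ k 3 (IsOrd-unique ord′ ord)
  M₃-at-1 : (B ^ k ∸ 1) ∣ S B N 3 k 1
  M₃-at-1 = subst (λ j → (B ^ j ∸ 1) ∣ S B N 3 j 1) k′≡k (M₃ 1 ≤-refl 1<N (gcd-zeroˡ N))
  open PeriodThree B N k 1<B 1<N ord M₃-at-1
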